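{- Let $P$ be a standard, range-restricted logic program in which, whenever a variable $X$ occurs both in a term of the head and in a term of the body of a rule, at most one of these terms is complex, and every complex term has nesting depth at most one. If for every rule $r\in P$ there exists $k\ge1$ such that $r$ does not depend on any cycle of $\Sigma_k(P)$, then $P$ is terminating, i.e., the bottom-up evaluation of $P$ (iterating its immediate consequence operator from the empty set) terminates.
   Context: A standard rule is $A\leftarrow B_1,\dots,B_k$ with atoms built from constants, variables and function symbols; a program is a finite set of rules. Immediate consequence operator: $T_P(I)=\{A\theta\mid A\leftarrow A_1,\dots,A_n\in P,\ \theta\text{ ground with }A_i\theta\in I\}$; bottom-up evaluation computes $T_P^1(\emptyset)\subseteq T_P^2(\emptyset)\subseteq\cdots$ up to the minimum model. Activation graph $\Sigma(P)$: nodes rules, edge $(r_1,r_2)$ iff $head(r_1)$ unifies with an atom of $body(r_2)$. A path $(r_1,r_2),\dots,(r_k,r_{k+1})$ of $\Sigma(P)$ is active if there are unifiers $\theta_1,\dots,\theta_k$ such that $head(r_1)$ unifies with an atom of $body(r_2)$ via $\theta_1$ and, for $i\in[2..k]$, $head(r_i)\theta_{i-1}$ unifies with an atom of $body(r_{i+1})$ via $\theta_i$. $\Sigma_k(P)$ has the rules as nodes and an edge $(r,s)$ iff there is an active path of length $k$ from $r$ to $s$. A node $r$ depends on a cycle if there is a path from some node of the cycle to $r$ (nodes on the cycle depend on it). -}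

module Defs where

open import Data.Nat using (ℕ; zero; suc; _⊔_; _≤_)
open import Data.List using (List; []; _∷_; _++_)
open import Data.List.Membership.Propositional using (_∈_)
open import Data.List.Relation.Unary.All using (All)
open import Data.Product using (Σ; ∃; _×_; _,_)
open import Data.Empty using (⊥)
open import Relation.Nullary using (¬_)
open import Relation.Binary.PropositionalEquality using (_≡_)
open import Relation.Binary.Construct.Closure.Transitive using (TransClosure)
open import Relation.Binary.Construct.Closure.ReflexiveTransitive using (Star)

data Term : Set where
  var   : ℕ → Term
  const : ℕ → Term
  fun   : ℕ → List Term → Term

record Atom : Set where
  constructor atom
  field
    pred : ℕ
    args : List Term
open Atom public

record Rule : Set where
  constructor _⇐_
  field
    head : Atom
    body : List Atom
open Rule public

Program : Set
Program = List Rule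

mutual
  vars : Term → List ℕ
  vars (var x)    = x ∷ []
  vars (const c)  = []
  vars (fun f ts) = varsL ts

  varsL : List Term → List ℕ
  varsL []       = []
  varsL (t ∷ ts) = vars t ++ varsL ts

varsA : Atom → List ℕ
varsA a = varsL (args a)

mutual
  depth : Term → ℕ
  depth (var x)    = 0
  depth (const c)  = 0
  depth (fun f ts) = suc (depthL ts)

  depthL : List Term → ℕ
  depthL []       = 0
  depthL (t ∷ ts) = depth t ⊔ depthL ts

data Complex : Term → Set where
  complex : ∀ f ts → Complex (fun f ts)

Subst : Set
Subst = ℕ → Term

mutual
  _⟨_⟩ : Term → Subst → Term
  var x ⟨ θ ⟩    = θ x
  const c ⟨ θ ⟩  = const c
  fun f ts ⟨ θ ⟩ = fun f (ts ⟨ θ ⟩L)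

  _⟨_⟩L : List Term → Subst → List Term
  [] ⟨ θ ⟩L       = []
  (t ∷ ts) ⟨ θ ⟩L = (t ⟨ θ ⟩) ∷ (ts ⟨ θ ⟩L)

_⟪_⟫ : Atom → Subst → Atom
atom p ts ⟪ θ ⟫ = atom p (ts ⟨ θ ⟩L)

Ground : Term → Set
Ground t = vars t ≡ []

GroundSubst : Subst → Set
GroundSubst θ = ∀ x → Ground (θ x)

Interp : Set₁
Interp = Atom → Set

T : Program → Interp → Interp
T P I A = Σ Rule λ r → r ∈ P × Σ Subst λ θ → GroundSubst θ ×
            (A ≡ head r ⟪ θ ⟫) × All (λ B → I (B ⟪ θ ⟫)) (body r)

∅ : Interp
∅ _ = ⊥

T^ : Program → ℕ → Interp
T^ P zero    = ∅
T^ P (suc n) = T P (T^ P n)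

Terminating : Program → Set
Terminating P = ∃ λ n → ∀ A → T^ P (suc n) A → T^ P n A

RangeRestricted : Program → Set
RangeRestricted P = ∀ r → r ∈ P → ∀ x → x ∈ varsA (head r) →
                      Σ Atom λ B → B ∈ body r × x ∈ varsA B

SharedVarCondition : Program → Set
SharedVarCondition P =
  ∀ r → r ∈ P → ∀ t → t ∈ args (head r) → ∀ B → B ∈ body r → ∀ u → u ∈ args B →
  ∀ x → x ∈ vars t → x ∈ vars u → ¬ (Complex t × Complex u)

DepthAtMostOne : Program → Set
DepthAtMostOne P = ∀ r → r ∈ P → ∀ A → A ∈ (head r ∷ body r) →
                   ∀ t → t ∈ args A → depth t ≤ 1

-- Rules are standardized apart: a unifier of two atoms coming from different
-- rule occurrences is represented by a pair of substitutions (σ, ρ), one for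
-- each side, with  A σ = B ρ.

-- ActivePath P H k s : there are rules r₂,…,r_{k+1} = s in P such that the
-- (instantiated) head H unifies with an atom of body(r₂) via θ₁, and for each
-- i, head(rᵢ)θ_{i-1} unifies with an atom of body(r_{i+1}) via θᵢ.
data ActivePath (P : Program) : Atom → ℕ → Rule → Set where
  last : ∀ {H s B} (σ ρ : Subst) → s ∈ P → B ∈ body s →
         H ⟪ σ ⟫ ≡ B ⟪ ρ ⟫ → ActivePath P H 1 s
  step : ∀ {H r s B k} (σ ρ : Subst) → r ∈ P → B ∈ body r →
         H ⟪ σ ⟫ ≡ B ⟪ ρ ⟫ → ActivePath P (head r ⟪ ρ ⟫) (suc k) s →
         ActivePath P H (suc (suc k)) s

Σ-edge : Program → ℕ → Rule → Rule → Set
Σ-edge P k r s = r ∈ P × ActivePath P (head r) k s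

DependsOnCycle : (Rule → Rule → Set) → Rule → Set
DependsOnCycle E r = Σ Rule λ c → TransClosure E c c × Star E c r

-- If T_P^(N+1)(∅) contains an atom that is not in T_P^N(∅), then its
-- derivation has depth N+1, so it contains a chain of rule instances
-- r₀, r₁, …, r_N of P in which the instantiated head of r_{i+1} equals an
-- instantiated body atom of r_i ("derivation chain").  Every segment of k
-- consecutive links of such a chain is an active path of length k, i.e. an
-- edge of Σ_k(P).  Choosing k for r₀ as in the hypothesis and N ≥ |P|·k, the
-- rules r₀, r_k, r_{2k}, …, r_{|P|k} form a walk of |P|+1 nodes in Σ_k(P)
-- ending in r₀; by the pigeonhole principle some rule repeats, giving a cycle
-- on which r₀ depends — a contradiction.  Hence T_P^(N+1)(∅) ⊆ T_P^N(∅).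
module Submission where

open import Defs
open import Data.Nat using (ℕ; _≥_; zero; suc; _+_; _*_; _⊔_; _≤_; _<_; z≤n; s≤s)
open import Data.Nat.Properties
  using (≤-trans; ≤-refl; *-monoˡ-≤; *-monoʳ-≤; m≤m⊔n; m≤n⊔m; m<1+n⇒m<n∨m≡n; <⇒≤; ≤-pred)
open import Data.List using (List; []; _∷_; length; lookup)
open import Data.List.Membership.Propositional using (_∈_)
open import Data.List.Relation.Unary.Any using (here; there; index)
open import Data.List.Relation.Unary.Any.Properties using (lookup-index)
open import Data.List.Relation.Unary.All as All using (All; []; _∷_)
open import Data.Fin using (Fin; toℕ)
open import Data.Fin.Properties using (pigeonhole; toℕ<n)
open import Data.Product using (Σ; _×_; _,_; proj₁; proj₂)
open import Data.Sum using (_⊎_; inj₁; inj₂)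
open import Data.Empty using (⊥; ⊥-elim)
open import Relation.Nullary using (¬_)
open import Relation.Binary.PropositionalEquality using (_≡_; refl; sym; trans; cong; cong₂; subst)
open import Relation.Binary.Construct.Closure.Transitive using (TransClosure; [_]; _∷_)
open import Relation.Binary.Construct.Closure.ReflexiveTransitive using (Star; ε; _◅_)

-- The identity substitution acts trivially; it serves as the unifier of an
-- already instantiated head along an active path.
mutual
  term-var : (t : Term) → t ⟨ var ⟩ ≡ t
  term-var (var x)    = refl
  term-var (const c)  = refl
  term-var (fun f ts) = cong (fun f) (terms-var ts)

  terms-var : (ts : List Term) → ts ⟨ var ⟩L ≡ ts
  terms-var []       = refl
  terms-var (t ∷ ts) = cong₂ _∷_ (term-var t) (terms-var ts)

atom-var : (A : Atom) → A ⟪ var ⟫ ≡ A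
atom-var (atom p ts) = cong (atom p) (terms-var ts)

index-injective : ∀ {A : Set} {x y : A} {xs} (p : x ∈ xs) (q : y ∈ xs) →
                  index p ≡ index q → x ≡ y
index-injective {xs = xs} p q eq =
  trans (lookup-index p) (trans (cong (lookup xs) eq) (sym (lookup-index q)))

allOrSome : ∀ {X Y : Atom → Set} (bs : List Atom) → All (λ B → X B ⊎ Y B) bs →
            All X bs ⊎ Σ Atom λ B → B ∈ bs × Y B
allOrSome []       []             = inj₁ []
allOrSome (b ∷ bs) (inj₂ y ∷ _)   = inj₂ (b , here refl , y)
allOrSome (b ∷ bs) (inj₁ x ∷ xys) with allOrSome bs xys
... | inj₁ xs           = inj₁ (x ∷ xs)
... | inj₂ (B , B∈ , y) = inj₂ (B , there B∈ , y)

upperBound : ∀ {A : Set} (xs : List A) (f : ∀ {x} → x ∈ xs → ℕ) →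
             Σ ℕ λ K → ∀ {x} (p : x ∈ xs) → f p ≤ K
upperBound []       f = 0 , λ ()
upperBound (x ∷ xs) f with upperBound xs (λ p → f (there p))
... | K , bound = f (here refl) ⊔ K , λ where
  (here refl) → m≤m⊔n _ _
  (there p)   → ≤-trans (bound p) (m≤n⊔m (f (here refl)) K)

-- A walk v_M → v_{M-1} → … → v₀ visiting |xs|+1 nodes from xs repeats a
-- node, so its endpoint v₀ depends on a cycle.
module LongWalk {E : Rule → Rule → Set} (xs : List Rule) (v : ℕ → Rule)
                (v∈xs : ∀ m → m ≤ length xs → v m ∈ xs)
                (edge : ∀ m → m < length xs → E (v (suc m)) (v m)) where

  descend : ∀ a b → a < b → b ≤ length xs → TransClosure E (v b) (v a)
  descend a (suc b) a<b b≤ with m<1+n⇒m<n∨m≡n a<b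
  ... | inj₁ a<b' = edge b b≤ ∷ descend a b a<b' (<⇒≤ b≤)
  ... | inj₂ refl = [ edge b b≤ ]

  reach : ∀ a → a ≤ length xs → Star E (v a) (v 0)
  reach zero    _  = ε
  reach (suc a) a≤ = edge a a≤ ◅ reach a (<⇒≤ a≤)

  bounded : (x : Fin (suc (length xs))) → toℕ x ≤ length xs
  bounded x = ≤-pred (toℕ<n x)

  position : Fin (suc (length xs)) → Fin (length xs)
  position x = index (v∈xs (toℕ x) (bounded x))

  dependsOnCycle : DependsOnCycle E (v 0)
  dependsOnCycle with pigeonhole ≤-refl position
  ... | i , j , i<j , samePosition =
    v (toℕ i) , cycle , reach (toℕ i) (bounded i)
    where
    cycle : TransClosure E (v (toℕ i)) (v (toℕ i))
    cycle = subst (λ x → TransClosure E x (v (toℕ i))) (sym (index-injective _ _ samePosition))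
                  (descend (toℕ i) (toℕ j) i<j (bounded j))

module _ (P : Program) where

  record Chain (L : ℕ) : Set where
    field
      rule  : ℕ → Rule
      inst  : ℕ → Subst
      rule∈ : ∀ i → i ≤ L → rule i ∈ P
      link  : ∀ i → i < L → Σ Atom λ B → B ∈ body (rule i) ×
                head (rule (suc i)) ⟪ inst (suc i) ⟫ ≡ B ⟪ inst i ⟫

  ChainTo : ℕ → Atom → Set
  ChainTo L A = Σ (Chain L) λ c → A ≡ head (Chain.rule c 0) ⟪ Chain.inst c 0 ⟫

  extend : ∀ {L r B} θ → r ∈ P → B ∈ body r → ChainTo L (B ⟪ θ ⟫) → Chain (suc L)
  extend {L} {r} {B} θ r∈ B∈ (c , start) =
    record { rule = rule′ ; inst = inst′ ; rule∈ = rule∈′ ; link = link′ }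
    where
    open Chain c
    rule′ : ℕ → Rule
    rule′ zero    = r
    rule′ (suc i) = rule i
    inst′ : ℕ → Subst
    inst′ zero    = θ
    inst′ (suc i) = inst i
    rule∈′ : ∀ i → i ≤ suc L → rule′ i ∈ P
    rule∈′ zero    _       = r∈
    rule∈′ (suc i) (s≤s i≤) = rule∈ i i≤
    link′ : ∀ i → i < suc L → Σ Atom λ B′ → B′ ∈ body (rule′ i) ×
              head (rule′ (suc i)) ⟪ inst′ (suc i) ⟫ ≡ B′ ⟪ inst′ i ⟫
    link′ zero    _        = B , B∈ , sym start
    link′ (suc i) (s≤s i<) = link i i<

  shortOrChain : ∀ j m A → T^ P m A → T^ P j A ⊎ ChainTo j A
  shortOrChain j       zero    A ()
  shortOrChain zero    (suc m) A (r , r∈ , θ , _ , A≡ , _) =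
    inj₂ (record { rule = λ _ → r ; inst = λ _ → θ ; rule∈ = λ _ _ → r∈ ; link = λ _ () } , A≡)
  shortOrChain (suc j) (suc m) A (r , r∈ , θ , ground , A≡ , premises)
    with allOrSome (body r) (All.map (λ {B} → shortOrChain j m (B ⟪ θ ⟫)) premises)
  ... | inj₁ short            = inj₁ (r , r∈ , θ , ground , A≡ , short)
  ... | inj₂ (B , B∈ , chain) = inj₂ (extend θ r∈ B∈ chain , A≡)

  module _ {L : ℕ} (c : Chain L) where
    open Chain c

    segment : ∀ k a (H : Atom) (σ : Subst) → H ⟪ σ ⟫ ≡ head (rule (suc k + a)) ⟪ inst (suc k + a) ⟫ →
              suc k + a ≤ L → ActivePath P H (suc k) (rule a)
    segment zero a H σ H≡ a< with link a a<
    ... | B , B∈ , linked = last σ (inst a) (rule∈ a (<⇒≤ a<)) B∈ (trans H≡ linked)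
    segment (suc k) a H σ H≡ a< with link (suc k + a) a<
    ... | B , B∈ , linked =
      step σ (inst (suc k + a)) (rule∈ (suc k + a) (<⇒≤ a<)) B∈ (trans H≡ linked)
           (segment k a _ var (atom-var _) (<⇒≤ a<))

    -- A chain of length ≥ |P|·(k+1) makes its first rule depend on a cycle
    -- of Σ_{k+1}(P): sample every (k+1)-th rule of the chain.
    chainDependsOnCycle : ∀ k → length P * suc k ≤ L → DependsOnCycle (Σ-edge P (suc k)) (rule 0)
    chainDependsOnCycle k long = LongWalk.dependsOnCycle P sample sample∈ edge
      where
      sample : ℕ → Rule
      sample m = rule (m * suc k)

      within : ∀ m → m ≤ length P → m * suc k ≤ L
      within m m≤ = ≤-trans (*-monoˡ-≤ (suc k) m≤) long

      sample∈ : ∀ m → m ≤ length P → sample m ∈ P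
      sample∈ m m≤ = rule∈ (m * suc k) (within m m≤)

      edge : ∀ m → m < length P → Σ-edge P (suc k) (sample (suc m)) (sample m)
      edge m m< = sample∈ (suc m) m< , segment k (m * suc k) _ (inst (suc m * suc k)) refl (within (suc m) m<)

corollary2 : (P : Program) → RangeRestricted P → SharedVarCondition P →
             DepthAtMostOne P →
             (∀ r → r ∈ P → Σ ℕ (λ k → k ≥ 1 × ¬ DependsOnCycle (Σ-edge P k) r)) →
             Terminating P
corollary2 P _ _ _ acyclic = N , stationary
  where
  -- K bounds the chosen k of every rule; no chain is as long as N = |P|·K.
  bounded : Σ ℕ λ K → ∀ {r} (r∈ : r ∈ P) → proj₁ (acyclic r r∈) ≤ K
  bounded = upperBound P (λ r∈ → proj₁ (acyclic _ r∈))

  K N : ℕ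
  K = proj₁ bounded
  N = length P * K

  noLongChain : ∀ {A} → ChainTo P N A → ⊥
  noLongChain (c , _) with acyclic _ (Chain.rule∈ c 0 z≤n) | proj₂ bounded (Chain.rule∈ c 0 z≤n)
  ... | suc k , _ , noCycle | k≤K =
    noCycle (chainDependsOnCycle P c k (*-monoʳ-≤ (length P) k≤K))

  stationary : ∀ A → T^ P (suc N) A → T^ P N A
  stationary A derived with shortOrChain P N (suc N) A derived
  ... | inj₁ short = short
  ... | inj₂ chain = ⊥-elim (noLongChain chain)
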